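{- The operators $\mathfrak N$ and $\mathfrak P$ on $k\{\mathcal T\}$ are adjoint with respect to the inner product $(\cdot,\cdot)$, i.e. $(\mathfrak N(x),y)=(x,\mathfrak P(y))$ for all $x,y\in k\{\mathcal T\}$.
   Context: A rooted tree is a finite partially ordered set (elements called vertices) with a unique greatest element, the root, such that for every vertex $v$ the set of vertices greater than $v$ is a chain; if $v$ covers $w$, $w$ is a child of $v$. We regard it as a directed graph with edges from each vertex to its children; a vertex is terminal if it has no children. Rooted trees are considered up to isomorphism; $\mathcal T$ is the set of finite rooted trees, $|t|$ the number of vertices, $\bullet$ the one-vertex tree. Write $t\lhd t'$ if $t$ is obtained from $t'$ by deleting one terminal non-root vertex and the edge into it. For $t\lhd t'$, $n(t;t')$ is the number of vertices of $t$ at which attaching a new edge to a new terminal vertex yields $t'$, and $m(t;t')$ is the number of edges of $t'$ whose removal (with their terminal endpoint) leaves $t$. For a vertex $v$ of $t$, $t_v$ is the rooted tree of $v$ and its descendants; if $v$ has children $v_1,\dots,v_k$, $SG(t,v)$ is the group generated by the exchanges of $t_{v_i}$ with $t_{v_j}$ whenever these are isomorphic; $SG(t)=\prod_v SG(t,v)$. Let $k$ be a field of characteristic $0$ and $k\{\mathcal T\}$ the vector space with basis $\mathcal T$. The growth operator is the linear map $\mathfrak N(t)=\sum_{t\lhd t'}n(t;t')t'$; the pruning operator is the linear map $\mathfrak P(t)=\sum_{t'\lhd t}m(t';t)t'$ for $t\ne\bullet$, $\mathfrak P(\bullet)=0$. The inner product on $k\{\mathcal T\}$ is the bilinear form with $(t,t')=|SG(t)|\,\delta_{t,t'}$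 for rooted trees $t,t'$. -}

module Defs where

open import Level using (Level; _⊔_)
open import Data.Nat as ℕ using (ℕ; zero; suc)
open import Data.Nat using (_!)
open import Data.Bool using (Bool; true; false; if_then_else_; _∧_)
open import Data.List using (List; []; _∷_; _++_; map; concatMap; foldr)
open import Data.Maybe using (Maybe; just; nothing)
open import Data.Product using (_×_; _,_)
open import Relation.Binary.PropositionalEquality using (_≡_)
open import Relation.Nullary using (¬_)
open import Algebra.Bundles using (CommutativeRing)
open import Algebra.Definitions using (Invertible)

ι : {c ℓ : Level} (R : CommutativeRing c ℓ) → ℕ → CommutativeRing.Carrier R
ι R zero    = CommutativeRing.0# R
ι R (suc n) = CommutativeRing._+_ R (CommutativeRing.1# R) (ι R n)

record IsFieldChar0 {c ℓ : Level} (R : CommutativeRing c ℓ) : Set (c ⊔ ℓ) where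
  open CommutativeRing R
  field
    nontrivial : ¬ (1# ≈ 0#)
    inverses   : ∀ x → ¬ (x ≈ 0#) → Invertible _≈_ 1# _*_ x
    char0      : ∀ n → ι R n ≈ 0# → n ≡ 0

-- Rooted trees: a vertex together with the (unordered) list of the
-- subtrees at its children.  Trees are regarded up to isomorphism: the
-- order of children is irrelevant (see _≅ᵇ_ below).

data Tree : Set where
  node : List Tree → Tree

• : Tree
• = node []

-- Decision of isomorphism of rooted trees.
-- node ts ≅ node us  iff  the children lists ts, us can be matched
-- bijectively by isomorphic subtrees (greedy matching is correct since
-- ≅ is an equivalence relation).

mutual
  _≅ᵇ_ : Tree → Tree → Bool
  node ts ≅ᵇ node us = matchAll ts us

  matchAll : List Tree → List Tree → Bool
  matchAll []       []      = true
  matchAll []       (_ ∷ _) = false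
  matchAll (t ∷ ts) us with removeIso t us
  ... | nothing  = false
  ... | just us' = matchAll ts us'

  removeIso : Tree → List Tree → Maybe (List Tree)
  removeIso t []       = nothing
  removeIso t (u ∷ us) with t ≅ᵇ u
  ... | true  = just us
  ... | false with removeIso t us
  ...   | nothing  = nothing
  ...   | just us' = just (u ∷ us')

-- SG(t,v) is generated by exchanging isomorphic subtrees at
-- the children of v, so it is the product over the isomorphism classes
-- of children of v of the symmetric groups on each class:
-- |SG(t,v)| = ∏_classes (multiplicity)! ; |SG(t)| = ∏_v |SG(t,v)|.

addToClasses : Tree → List (Tree × ℕ) → List (Tree × ℕ)
addToClasses t []             = (t , 1) ∷ []
addToClasses t ((r , m) ∷ cs) =
  if t ≅ᵇ r then (r , suc m) ∷ cs else (r , m) ∷ addToClasses t cs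

classes : List Tree → List (Tree × ℕ)
classes []       = []
classes (t ∷ ts) = addToClasses t (classes ts)

localSG : List Tree → ℕ
localSG ts = foldr (λ { (_ , m) acc → (m !) ℕ.* acc }) 1 (classes ts)

mutual
  ∣SG∣ : Tree → ℕ
  ∣SG∣ (node ts) = localSG ts ℕ.* ∣SG∣L ts

  ∣SG∣L : List Tree → ℕ
  ∣SG∣L []       = 1
  ∣SG∣L (t ∷ ts) = ∣SG∣ t ℕ.* ∣SG∣L ts

-- Growth: the list (with repetitions) of the trees t' obtained by
-- attaching a new edge to a new terminal vertex at each vertex of t.
-- Each t' with t ◁ t' occurs exactly n(t;t') times (up to ≅).

mutual
  grow : Tree → List Tree
  grow (node ts) = node (• ∷ ts) ∷ map node (growL ts)

  growL : List Tree → List (List Tree)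
  growL []       = []
  growL (t ∷ ts) = map (_∷ ts) (grow t) ++ map (t ∷_) (growL ts)

-- Pruning: the list (with repetitions) of the trees obtained by deleting
-- a terminal non-root vertex (and the edge into it), one for each such
-- vertex.  Each t' with t' ◁ t occurs exactly m(t';t) times (up to ≅);
-- prune • = [].

mutual
  prune : Tree → List Tree
  prune (node ts) = map node (pruneL ts)

  pruneL : List Tree → List (List Tree)
  pruneL []                    = []
  pruneL (node [] ∷ ts)        = ts ∷ map (• ∷_) (pruneL ts)
  pruneL (t@(node (_ ∷ _)) ∷ ts) =
    map (_∷ ts) (prune t) ++ map (t ∷_) (pruneL ts)

module FreeSpace {c ℓ : Level} (R : CommutativeRing c ℓ) where
  open CommutativeRing R

  -- an element of k{T}: a formal linear combination Σ aᵢ tᵢ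
  kT : Set c
  kT = List (Carrier × Tree)

  extend : (Tree → List Tree) → kT → kT
  extend f = concatMap (λ { (a , t) → map (a ,_) (f t) })

  -- growth operator 𝔑(t) = Σ_{t ◁ t'} n(t;t') t'
  𝔑 : kT → kT
  𝔑 = extend grow

  -- pruning operator 𝔓(t) = Σ_{t' ◁ t} m(t';t) t',  𝔓(•) = 0
  𝔓 : kT → kT
  𝔓 = extend prune

  ⟪_,_⟫ₜ : Tree → Tree → Carrier
  ⟪ t , t' ⟫ₜ = if t ≅ᵇ t' then ι R (∣SG∣ t) else 0#

  Σₖ : List Carrier → Carrier
  Σₖ = foldr _+_ 0#

  ⟪_,_⟫ : kT → kT → Carrier
  ⟪ x , y ⟫ =
    Σₖ (map (λ { (a , t) → Σₖ (map (λ { (b , u) → a * b * ⟪ t , u ⟫ₜ }) y) }) x)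

{-# OPTIONS --safe #-}
-- Both sides are bilinear, so it suffices to compare them on trees t and u, where the claim
-- is the integer identity  Σ_{t′ ∈ grow t} ⟨t′, u⟩ = Σ_{u′ ∈ prune u} ⟨t, u′⟩  with
-- ⟨t, u⟩ = |SG(t)| δ_{t,u}.  Write t = node ts and u = node us.  Growing t either adds a
-- leaf at the root or grows one child a of t; pruning u either deletes a leaf child of u
-- or prunes one child b of u.  The pairing of two forests expands along the choice of one
-- tree of the second forest: ⟨x ∷ xs, us⟩ = Σ_{b ∈ us} ⟨x, b⟩ ⟨xs, us ∖ b⟩, because the
-- number of children of u matching x is exactly the factor by which |SG(node (x ∷ xs))|
-- exceeds |SG(x)| |SG(node xs)|.  Expanding both sides this way, the root-leaf terms
-- agree, and the remaining terms are
--   Σ_{a ∈ ts} Σ_{b ∈ us} (Σ_{a′ ∈ grow a} ⟨a′, b⟩) ⟨ts ∖ a, us ∖ b⟩   and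
--   Σ_{a ∈ ts} Σ_{b ∈ us} (Σ_{b′ ∈ prune b} ⟨a, b′⟩) ⟨ts ∖ a, us ∖ b⟩,
-- which agree by induction on t.
module Submission where

open import Defs
open import Level using (Level)
open import Algebra.Bundles using (CommutativeRing; CommutativeSemiring)
open import Data.List using (List; []; _∷_; _++_; map; concatMap; foldr)
open import Data.List.Relation.Unary.All as All using (All; []; _∷_)
open import Data.Product using (_×_; _,_; proj₁; proj₂; map₂; ∃)
open import Function using (_∘_)

module ListSum {c ℓ} (S : CommutativeSemiring c ℓ) where
  open CommutativeSemiring S
  open import Algebra.Properties.CommutativeSemigroup +-commutativeSemigroup using (interchange)

  private variable
    a b : Level
    A : Set a
    B : Set b

  ∑ : (A → Carrier) → List A → Carrier
  ∑ f xs = foldr _+_ 0# (map f xs)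

  infixl 10 ∑
  syntax ∑ (λ x → e) xs = ∑[ x ← xs ] e

  ∑-++ : (f : A → Carrier) (xs ys : List A) → ∑ f (xs ++ ys) ≈ ∑ f xs + ∑ f ys
  ∑-++ f []       ys = sym (+-identityˡ _)
  ∑-++ f (x ∷ xs) ys = trans (+-congˡ (∑-++ f xs ys)) (sym (+-assoc _ _ _))

  ∑-map : (f : B → Carrier) (g : A → B) (xs : List A) → ∑ f (map g xs) ≈ ∑ (f ∘ g) xs
  ∑-map f g []       = refl
  ∑-map f g (x ∷ xs) = +-congˡ (∑-map f g xs)

  ∑-concatMap : (f : B → Carrier) (g : A → List B) (xs : List A) →
                ∑ f (concatMap g xs) ≈ ∑[ x ← xs ] ∑ f (g x)
  ∑-concatMap f g []       = refl
  ∑-concatMap f g (x ∷ xs) = trans (∑-++ f (g x) _) (+-congˡ (∑-concatMap f g xs))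

  ∑-cong-All : {f g : A → Carrier} (xs : List A) → All (λ x → f x ≈ g x) xs → ∑ f xs ≈ ∑ g xs
  ∑-cong-All []       []       = refl
  ∑-cong-All (x ∷ xs) (p ∷ ps) = +-cong p (∑-cong-All xs ps)

  ∑-cong : {f g : A → Carrier} → (∀ x → f x ≈ g x) → (xs : List A) → ∑ f xs ≈ ∑ g xs
  ∑-cong f≈g xs = ∑-cong-All xs (All.universal f≈g xs)

  ∑-zero : (xs : List A) → ∑[ x ← xs ] 0# ≈ 0#
  ∑-zero []       = refl
  ∑-zero (x ∷ xs) = trans (+-identityˡ _) (∑-zero xs)

  ∑-distrib-+ : (f g : A → Carrier) (xs : List A) → ∑[ x ← xs ] (f x + g x) ≈ ∑ f xs + ∑ g xs
  ∑-distrib-+ f g []       = sym (+-identityˡ 0#)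
  ∑-distrib-+ f g (x ∷ xs) = trans (+-congˡ (∑-distrib-+ f g xs)) (interchange _ _ _ _)

  *-distribˡ-∑ : ∀ k (f : A → Carrier) (xs : List A) → k * ∑ f xs ≈ ∑[ x ← xs ] (k * f x)
  *-distribˡ-∑ k f []       = zeroʳ k
  *-distribˡ-∑ k f (x ∷ xs) = trans (distribˡ k _ _) (+-congˡ (*-distribˡ-∑ k f xs))

  *-distribʳ-∑ : ∀ k (f : A → Carrier) (xs : List A) → ∑ f xs * k ≈ ∑[ x ← xs ] (f x * k)
  *-distribʳ-∑ k f []       = zeroˡ k
  *-distribʳ-∑ k f (x ∷ xs) = trans (distribʳ k _ _) (+-congˡ (*-distribʳ-∑ k f xs))

  ∑-comm : (f : A → B → Carrier) (xs : List A) (ys : List B) →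
           ∑[ x ← xs ] ∑[ y ← ys ] f x y ≈ ∑[ y ← ys ] ∑[ x ← xs ] f x y
  ∑-comm f []       ys = sym (∑-zero ys)
  ∑-comm f (x ∷ xs) ys = trans (+-congˡ (∑-comm f xs ys)) (sym (∑-distrib-+ (f x) _ ys))

  ∑-comm-distribʳ : (f : A → B → Carrier) (g : B → Carrier) (xs : List A) (ys : List B) →
                    ∑[ x ← xs ] ∑[ y ← ys ] (f x y * g y) ≈ ∑[ y ← ys ] (∑[ x ← xs ] f x y * g y)
  ∑-comm-distribʳ f g xs ys =
    trans (∑-comm _ xs ys) (∑-cong (λ y → sym (*-distribʳ-∑ (g y) (λ x → f x y) xs)) ys)

module Bilinear {c ℓ} (k : CommutativeRing c ℓ) where
  open CommutativeRing k
  open FreeSpace k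
  open ListSum commutativeSemiring
  open import Relation.Binary.Reasoning.Setoid setoid

  ⟪⟫-extendˡ : ∀ f x y →
               ⟪ extend f x , y ⟫ ≈
               ∑[ p ← x ] ∑[ q ← y ] (proj₁ p * proj₁ q * ∑[ t′ ← f (proj₂ p) ] ⟪ t′ , proj₂ q ⟫ₜ)
  ⟪⟫-extendˡ f x y = begin
    ⟪ extend f x , y ⟫
      ≈⟨ ∑-concatMap _ (λ p → map (proj₁ p ,_) (f (proj₂ p))) x ⟩
    ∑[ p ← x ] ∑[ p′ ← map (proj₁ p ,_) (f (proj₂ p)) ] ∑[ q ← y ]
      (proj₁ p′ * proj₁ q * ⟪ proj₂ p′ , proj₂ q ⟫ₜ)
      ≈⟨ ∑-cong (λ p → trans (∑-map _ (proj₁ p ,_) (f (proj₂ p))) (∑-comm _ (f (proj₂ p)) y)) x ⟩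
    ∑[ p ← x ] ∑[ q ← y ] ∑[ t′ ← f (proj₂ p) ] (proj₁ p * proj₁ q * ⟪ t′ , proj₂ q ⟫ₜ)
      ≈⟨ ∑-cong (λ p → ∑-cong (λ q → sym (*-distribˡ-∑ _ _ (f (proj₂ p)))) y) x ⟩
    ∑[ p ← x ] ∑[ q ← y ] (proj₁ p * proj₁ q * ∑[ t′ ← f (proj₂ p) ] ⟪ t′ , proj₂ q ⟫ₜ) ∎

  ⟪⟫-extendʳ : ∀ g x y →
               ⟪ x , extend g y ⟫ ≈
               ∑[ p ← x ] ∑[ q ← y ] (proj₁ p * proj₁ q * ∑[ u′ ← g (proj₂ q) ] ⟪ proj₂ p , u′ ⟫ₜ)
  ⟪⟫-extendʳ g x y = ∑-cong (λ p → begin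
    ∑[ q′ ← extend g y ] (proj₁ p * proj₁ q′ * ⟪ proj₂ p , proj₂ q′ ⟫ₜ)
      ≈⟨ ∑-concatMap _ (λ q → map (proj₁ q ,_) (g (proj₂ q))) y ⟩
    ∑[ q ← y ] ∑[ q′ ← map (proj₁ q ,_) (g (proj₂ q)) ] (proj₁ p * proj₁ q′ * ⟪ proj₂ p , proj₂ q′ ⟫ₜ)
      ≈⟨ ∑-cong (λ q → trans (∑-map _ (proj₁ q ,_) (g (proj₂ q)))
                             (sym (*-distribˡ-∑ _ _ (g (proj₂ q))))) y ⟩
    ∑[ q ← y ] (proj₁ p * proj₁ q * ∑[ u′ ← g (proj₂ q) ] ⟪ proj₂ p , u′ ⟫ₜ) ∎) x

  extend-adjoint : ∀ f g → (∀ t u → ∑[ t′ ← f t ] ⟪ t′ , u ⟫ₜ ≈ ∑[ u′ ← g u ] ⟪ t , u′ ⟫ₜ) →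
                   ∀ x y → ⟪ extend f x , y ⟫ ≈ ⟪ x , extend g y ⟫
  extend-adjoint f g adjoint x y = begin
    ⟪ extend f x , y ⟫
      ≈⟨ ⟪⟫-extendˡ f x y ⟩
    ∑[ p ← x ] ∑[ q ← y ] (proj₁ p * proj₁ q * ∑[ t′ ← f (proj₂ p) ] ⟪ t′ , proj₂ q ⟫ₜ)
      ≈⟨ ∑-cong (λ p → ∑-cong (λ q → *-congˡ (adjoint (proj₂ p) (proj₂ q))) y) x ⟩
    ∑[ p ← x ] ∑[ q ← y ] (proj₁ p * proj₁ q * ∑[ u′ ← g (proj₂ q) ] ⟪ proj₂ p , u′ ⟫ₜ)
      ≈⟨ ⟪⟫-extendʳ g x y ⟨
    ⟪ x , extend g y ⟫ ∎

-- Imported only here, since they would clash with the semiring operations opened above.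
open import Data.Bool using (Bool; true; false; if_then_else_)
open import Data.Bool.Properties using (⇔→≡; if-float)
open import Data.Empty using (⊥-elim)
import Data.List.Relation.Unary.All.Properties as All
open import Data.List.Relation.Unary.AllPairs using (AllPairs; []; _∷_)
open import Data.Maybe using (just; nothing)
open import Data.Nat using (ℕ; zero; suc; _+_; _*_; _≤_; _⊔_; _!; s≤s⁻¹)
open import Data.Nat.Properties
  using ( +-*-commutativeSemiring; +-commutativeSemigroup; *-commutativeSemigroup
        ; +-identityʳ; +-assoc; +-cancelˡ-≡; *-identityˡ; *-zeroʳ; *-assoc; *-comm
        ; [m*n]*[o*p]≡[m*o]*[n*p]; 0≢1+n; 1+n≢0
        ; m≤m⊔n; m≤n⊔m; m≤n⇒m≤n⊔o; m⊔n≤o⇒m≤o; m⊔n≤o⇒n≤o )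
open import Data.Nat.Tactic.RingSolver using (solve-∀)
open import Data.Unit using (⊤; tt)
open import Function using (mk⇔)
open import Relation.Binary.PropositionalEquality
open import Relation.Nullary.Negation using (contradiction)
import Algebra.Properties.CommutativeSemigroup as CommutativeSemigroupProperties

open ListSum +-*-commutativeSemiring
module +-CS = CommutativeSemigroupProperties +-commutativeSemigroup
module *-CS = CommutativeSemigroupProperties *-commutativeSemigroup

-- Isomorphism of rooted trees

δ : Bool → ℕ
δ true  = 1
δ false = 0

infix 4 _≅_ _~_

record _≅_ (t u : Tree) : Set where
  constructor mk≅
  field ≅ᵇ≡true : (t ≅ᵇ u) ≡ true
open _≅_

⇔→≅ᵇ≡ : ∀ {a b c d} → (a ≅ b → c ≅ d) → (c ≅ d → a ≅ b) → (a ≅ᵇ b) ≡ (c ≅ᵇ d)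
⇔→≅ᵇ≡ to from = ⇔→≡ (mk⇔ (≅ᵇ≡true ∘ to ∘ mk≅) (≅ᵇ≡true ∘ from ∘ mk≅))

count : Tree → List Tree → ℕ
count w = ∑ (λ a → δ (w ≅ᵇ a))

mutual
  ≅ᵇ-refl : ∀ t → (t ≅ᵇ t) ≡ true
  ≅ᵇ-refl (node ts) = matchAll-refl ts

  matchAll-refl : ∀ ts → matchAll ts ts ≡ true
  matchAll-refl []       = refl
  matchAll-refl (t ∷ ts) rewrite ≅ᵇ-refl t = matchAll-refl ts

count-here : ∀ x us → count x (x ∷ us) ≡ suc (count x us)
count-here x us rewrite ≅ᵇ-refl x = refl

removeIso-nothing : ∀ x us → removeIso x us ≡ nothing → count x us ≡ 0
removeIso-nothing x []       _  = refl
removeIso-nothing x (u ∷ us) eq with x ≅ᵇ u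
removeIso-nothing x (u ∷ us) () | true
... | false with removeIso x us in r
...   | nothing = removeIso-nothing x us r
removeIso-nothing x (u ∷ us) () | false | just _

-- matchAll ts us compares ts and us by counting isomorphic copies only where ≅ᵇ is already
-- an equivalence on all trees involved, so symmetry and transitivity of ≅ᵇ are proved for
-- trees of bounded height, by induction on the bound.
record ≅-EquivalenceOn (P : Tree → Set) : Set where
  field
    symmetric  : ∀ {a b} → P a → P b → a ≅ b → b ≅ a
    transitive : ∀ {a b c} → P a → P b → P c → a ≅ b → b ≅ c → a ≅ c

module MatchAllByCounts {P : Tree → Set} (equiv : ≅-EquivalenceOn P) where
  open ≅-EquivalenceOn equiv renaming (symmetric to ≅-sym; transitive to ≅-trans)

  ≅ᵇ-respʳ : ∀ {w x u} → P w → P x → P u → x ≅ u → (w ≅ᵇ x) ≡ (w ≅ᵇ u)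
  ≅ᵇ-respʳ pw px pu x≅u =
    ⇔→≅ᵇ≡ (λ w≅x → ≅-trans pw px pu w≅x x≅u) (λ w≅u → ≅-trans pw pu px w≅u (≅-sym px pu x≅u))

  removeIso-just : ∀ {x us us′} → P x → All P us → removeIso x us ≡ just us′ →
                   All P us′ × (∀ {w} → P w → count w us ≡ δ (w ≅ᵇ x) + count w us′)
  removeIso-just {x} {u ∷ us} px (pu ∷ pus) eq with x ≅ᵇ u in x≅u
  removeIso-just {x} {u ∷ us} px (pu ∷ pus) refl | true =
    pus , λ {w} pw → cong (λ b → δ b + count w us) (≅ᵇ-respʳ pw pu px (≅-sym px pu (mk≅ x≅u)))
  ... | false with removeIso x us in r
  removeIso-just {x} {u ∷ us} px (pu ∷ pus) refl | false | just us′ =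
    let pus′ , count≡ = removeIso-just px pus r
    in pu ∷ pus′ , λ {w} pw → trans (cong (δ (w ≅ᵇ u) +_) (count≡ pw))
                                    (+-CS.x∙yz≈y∙xz (δ (w ≅ᵇ u)) (δ (w ≅ᵇ x)) _)

  matchAll⇒count≡ : ∀ {ts us} → All P ts → All P us → matchAll ts us ≡ true →
                    ∀ {w} → P w → count w ts ≡ count w us
  matchAll⇒count≡ {[]}     {[]} _          _   _ _  = refl
  matchAll⇒count≡ {x ∷ xs} {us} (px ∷ pxs) pus m pw with removeIso x us in r
  ... | just us′ =
    let pus′ , count≡ = removeIso-just px pus r
    in trans (cong (δ _ +_) (matchAll⇒count≡ pxs pus′ m pw)) (sym (count≡ pw))

  count≡⇒matchAll : ∀ {ts us} → All P ts → All P us → (∀ {w} → P w → count w ts ≡ count w us) →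
                    matchAll ts us ≡ true
  count≡⇒matchAll {[]}     {[]}     _          _        _      = refl
  count≡⇒matchAll {[]}     {u ∷ us} _          (pu ∷ _) count≡ =
    ⊥-elim (0≢1+n (trans (count≡ pu) (count-here u us)))
  count≡⇒matchAll {x ∷ xs} {us}     (px ∷ pxs) pus      count≡ with removeIso x us in r
  ... | nothing =
    ⊥-elim (1+n≢0 (trans (sym (count-here x xs)) (trans (count≡ px) (removeIso-nothing x us r))))
  ... | just us′ =
    let pus′ , count≡′ = removeIso-just px pus r
    in count≡⇒matchAll pxs pus′ (λ pw → +-cancelˡ-≡ _ _ _ (trans (count≡ pw) (count≡′ pw)))

mutual
  height : Tree → ℕ
  height (node ts) = suc (heights ts)

  heights : List Tree → ℕ
  heights []       = 0
  heights (t ∷ ts) = height t ⊔ heights ts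

All-height≤ : ∀ {n} ts → heights ts ≤ n → All (λ t → height t ≤ n) ts
All-height≤ []       _ = []
All-height≤ (t ∷ ts) h = m⊔n≤o⇒m≤o (height t) _ h ∷ All-height≤ ts (m⊔n≤o⇒n≤o (height t) _ h)

≅-equivalenceOn-height≤ : ∀ n → ≅-EquivalenceOn (λ t → height t ≤ n)
≅-equivalenceOn-height≤ zero    =
  record { symmetric = λ { {node _} () } ; transitive = λ { {node _} () } }
≅-equivalenceOn-height≤ (suc n) = record { symmetric = ≅-sym ; transitive = ≅-trans }
  where
  open MatchAllByCounts (≅-equivalenceOn-height≤ n)

  children : ∀ ts → height (node ts) ≤ suc n → All (λ t → height t ≤ n) ts
  children ts h = All-height≤ ts (s≤s⁻¹ h)

  ≅-sym : ∀ {a b} → height a ≤ suc n → height b ≤ suc n → a ≅ b → b ≅ a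
  ≅-sym {node ts} {node us} ha hb (mk≅ a≅b) = mk≅ (
    count≡⇒matchAll (children us hb) (children ts ha)
      (λ pw → sym (matchAll⇒count≡ (children ts ha) (children us hb) a≅b pw)))

  ≅-trans : ∀ {a b c} → height a ≤ suc n → height b ≤ suc n → height c ≤ suc n →
            a ≅ b → b ≅ c → a ≅ c
  ≅-trans {node ts} {node us} {node vs} ha hb hc (mk≅ a≅b) (mk≅ b≅c) = mk≅ (
    count≡⇒matchAll (children ts ha) (children vs hc)
      (λ pw → trans (matchAll⇒count≡ (children ts ha) (children us hb) a≅b pw)
                    (matchAll⇒count≡ (children us hb) (children vs hc) b≅c pw)))

≅-refl : ∀ {t} → t ≅ t
≅-refl {t} = mk≅ (≅ᵇ-refl t)

≅-sym : ∀ {a b} → a ≅ b → b ≅ a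
≅-sym {a} {b} = symmetric (m≤m⊔n (height a) (height b)) (m≤n⊔m (height a) (height b))
  where open ≅-EquivalenceOn (≅-equivalenceOn-height≤ (height a ⊔ height b))

≅-trans : ∀ {a b c} → a ≅ b → b ≅ c → a ≅ c
≅-trans {a} {b} {c} =
  transitive (m≤n⇒m≤n⊔o (height c) (m≤m⊔n (height a) (height b)))
             (m≤n⇒m≤n⊔o (height c) (m≤n⊔m (height a) (height b)))
             (m≤n⊔m (height a ⊔ height b) (height c))
  where open ≅-EquivalenceOn (≅-equivalenceOn-height≤ (height a ⊔ height b ⊔ height c))

≅ᵇ-sym : ∀ a b → (a ≅ᵇ b) ≡ (b ≅ᵇ a)
≅ᵇ-sym a b = ⇔→≅ᵇ≡ (≅-sym {a} {b}) (≅-sym {b} {a})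

≅ᵇ-respˡ : ∀ {a b} x → a ≅ b → (a ≅ᵇ x) ≡ (b ≅ᵇ x)
≅ᵇ-respˡ {a} {b} x a≅b = ⇔→≅ᵇ≡ {a} {x} {b} {x} (≅-trans (≅-sym a≅b)) (≅-trans a≅b)

≅ᵇ-respʳ : ∀ {a b} x → a ≅ b → (x ≅ᵇ a) ≡ (x ≅ᵇ b)
≅ᵇ-respʳ {a} {b} x a≅b =
  ⇔→≅ᵇ≡ {x} {a} {x} {b} (λ x≅a → ≅-trans x≅a a≅b) (λ x≅b → ≅-trans x≅b (≅-sym a≅b))

count-resp-≅ : ∀ {a b} xs → a ≅ b → count a xs ≡ count b xs
count-resp-≅ xs a≅b = ∑-cong (λ x → cong δ (≅ᵇ-respˡ x a≅b)) xs

record _~_ (ts us : List Tree) : Set where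
  constructor mk~
  field count≡ : ∀ w → count w ts ≡ count w us
open _~_

~-refl : ∀ {ts} → ts ~ ts
~-refl = mk~ λ w → refl

~-sym : ∀ {ts us} → ts ~ us → us ~ ts
~-sym h = mk~ λ w → sym (count≡ h w)

~-trans : ∀ {ts us vs} → ts ~ us → us ~ vs → ts ~ vs
~-trans h g = mk~ λ w → trans (count≡ h w) (count≡ g w)

~-∷ : ∀ {x y xs ys} → x ≅ y → xs ~ ys → x ∷ xs ~ y ∷ ys
~-∷ x≅y h = mk~ λ w → cong₂ (λ b n → δ b + n) (≅ᵇ-respʳ w x≅y) (count≡ h w)

~-∷⁻ : ∀ {x y xs ys} → x ≅ y → x ∷ xs ~ y ∷ ys → xs ~ ys
~-∷⁻ {x} x≅y h = mk~ λ w →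
  +-cancelˡ-≡ (δ (w ≅ᵇ x)) _ _ (trans (count≡ h w) (cong (λ b → δ b + _) (≅ᵇ-respʳ w (≅-sym x≅y))))

~-swap : ∀ x y zs → x ∷ y ∷ zs ~ y ∷ x ∷ zs
~-swap x y zs = mk~ λ w → +-CS.x∙yz≈y∙xz (δ (w ≅ᵇ x)) (δ (w ≅ᵇ y)) (count w zs)

≅-equivalence : ≅-EquivalenceOn (λ _ → ⊤)
≅-equivalence = record { symmetric = λ _ _ → ≅-sym ; transitive = λ _ _ _ → ≅-trans }

private
  module Universal = MatchAllByCounts ≅-equivalence

  all-tt : ∀ (ts : List Tree) → All (λ _ → ⊤) ts
  all-tt = All.universal (λ _ → tt)

node-≅⇒~ : ∀ {ts us} → node ts ≅ node us → ts ~ us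
node-≅⇒~ {ts} {us} (mk≅ m) = mk~ λ w → Universal.matchAll⇒count≡ (all-tt ts) (all-tt us) m {w} tt

~⇒node-≅ : ∀ {ts us} → ts ~ us → node ts ≅ node us
~⇒node-≅ {ts} {us} h =
  mk≅ (Universal.count≡⇒matchAll (all-tt ts) (all-tt us) (λ {w} _ → count≡ h w))

-- Symmetry factors

classProduct : List (Tree × ℕ) → ℕ
classProduct = foldr (λ c acc → proj₂ c ! * acc) 1

classCount : Tree → List (Tree × ℕ) → ℕ
classCount w = ∑ (λ c → if w ≅ᵇ proj₁ c then proj₂ c else 0)

NonIsoFrom : Tree → List (Tree × ℕ) → Set
NonIsoFrom r = All (λ c → (r ≅ᵇ proj₁ c) ≡ false)

DistinctClasses : List (Tree × ℕ) → Set
DistinctClasses = AllPairs (λ c d → (proj₁ c ≅ᵇ proj₁ d) ≡ false)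

classCount-nonIso : ∀ {x} r cs → NonIsoFrom r cs → x ≅ r → classCount x cs ≡ 0
classCount-nonIso     r []             []             _   = refl
classCount-nonIso {x} r ((s , m) ∷ cs) (r≇s ∷ r≇cs) x≅r with x ≅ᵇ s in x≅s
... | true  = contradiction (trans (sym (≅ᵇ≡true (≅-trans (≅-sym x≅r) (mk≅ x≅s)))) r≇s) λ ()
... | false = classCount-nonIso r cs r≇cs x≅r

classProduct-addToClasses : ∀ x cs → DistinctClasses cs →
                            classProduct (addToClasses x cs) ≡ suc (classCount x cs) * classProduct cs
classProduct-addToClasses x []             _            = refl
classProduct-addToClasses x ((r , m) ∷ cs) (r≇cs ∷ dcs) with x ≅ᵇ r in x≅r
... | true  = begin
  suc m ! * classProduct cs                           ≡⟨ *-assoc (suc m) (m !) _ ⟩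
  suc m * (m ! * classProduct cs)                     ≡⟨ cong (λ n → suc n * (m ! * classProduct cs)) m≡m+0 ⟩
  suc (m + classCount x cs) * (m ! * classProduct cs) ∎
  where
  open ≡-Reasoning
  m≡m+0 : m ≡ m + classCount x cs
  m≡m+0 = sym (trans (cong (m +_) (classCount-nonIso {x} r cs r≇cs (mk≅ x≅r))) (+-identityʳ m))
... | false rewrite classProduct-addToClasses x cs dcs =
  *-CS.x∙yz≈y∙xz (m !) (suc (classCount x cs)) _

classCount-addToClasses : ∀ w x cs → classCount w (addToClasses x cs) ≡ δ (w ≅ᵇ x) + classCount w cs
classCount-addToClasses w x [] with w ≅ᵇ x
... | true  = refl
... | false = refl
classCount-addToClasses w x ((r , m) ∷ cs) with x ≅ᵇ r in x≅r
... | true  = begin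
  (if w ≅ᵇ r then suc m else 0) + classCount w cs
    ≡⟨ cong (_+ classCount w cs) (if-suc (w ≅ᵇ r)) ⟩
  (δ (w ≅ᵇ r) + (if w ≅ᵇ r then m else 0)) + classCount w cs
    ≡⟨ +-assoc (δ (w ≅ᵇ r)) _ _ ⟩
  δ (w ≅ᵇ r) + ((if w ≅ᵇ r then m else 0) + classCount w cs)
    ≡⟨ cong (λ b → δ b + _) (≅ᵇ-respʳ w (≅-sym (mk≅ x≅r))) ⟩
  δ (w ≅ᵇ x) + ((if w ≅ᵇ r then m else 0) + classCount w cs) ∎
  where
  open ≡-Reasoning
  if-suc : ∀ b → (if b then suc m else 0) ≡ δ b + (if b then m else 0)
  if-suc true  = refl
  if-suc false = refl
... | false = trans (cong ((if w ≅ᵇ r then m else 0) +_) (classCount-addToClasses w x cs))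
                    (+-CS.x∙yz≈y∙xz (if w ≅ᵇ r then m else 0) (δ (w ≅ᵇ x)) _)

nonIsoFrom-addToClasses : ∀ r x cs → (r ≅ᵇ x) ≡ false → NonIsoFrom r cs → NonIsoFrom r (addToClasses x cs)
nonIsoFrom-addToClasses r x []             r≇x []           = r≇x ∷ []
nonIsoFrom-addToClasses r x ((s , m) ∷ cs) r≇x (r≇s ∷ r≇cs) with x ≅ᵇ s
... | true  = r≇s ∷ r≇cs
... | false = r≇s ∷ nonIsoFrom-addToClasses r x cs r≇x r≇cs

distinct-addToClasses : ∀ x cs → DistinctClasses cs → DistinctClasses (addToClasses x cs)
distinct-addToClasses x []             []           = [] ∷ []
distinct-addToClasses x ((r , m) ∷ cs) (r≇cs ∷ dcs) with x ≅ᵇ r in x≅r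
... | true  = r≇cs ∷ dcs
... | false = nonIsoFrom-addToClasses r x cs (trans (≅ᵇ-sym r x) x≅r) r≇cs
            ∷ distinct-addToClasses x cs dcs

distinct-classes : ∀ ts → DistinctClasses (classes ts)
distinct-classes []       = []
distinct-classes (t ∷ ts) = distinct-addToClasses t (classes ts) (distinct-classes ts)

classCount-classes : ∀ w ts → classCount w (classes ts) ≡ count w ts
classCount-classes w []       = refl
classCount-classes w (t ∷ ts) =
  trans (classCount-addToClasses w t (classes ts)) (cong (δ (w ≅ᵇ t) +_) (classCount-classes w ts))

localSG-∷ : ∀ x ts → localSG (x ∷ ts) ≡ suc (count x ts) * localSG ts
localSG-∷ x ts = trans (classProduct-addToClasses x (classes ts) (distinct-classes ts))
                       (cong (λ n → suc n * localSG ts) (classCount-classes x ts))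

splitFactor : Tree → List Tree → ℕ
splitFactor x ts = suc (count x ts) * ∣SG∣ x * ∣SG∣ (node ts)

∣SG∣-∷ : ∀ x ts → ∣SG∣ (node (x ∷ ts)) ≡ splitFactor x ts
∣SG∣-∷ x ts rewrite localSG-∷ x ts =
  [m*n]*[o*p]≡[m*o]*[n*p] (suc (count x ts)) (localSG ts) (∣SG∣ x) (∣SG∣L ts)

picks : List Tree → List (Tree × List Tree)
picks []       = []
picks (x ∷ xs) = (x , xs) ∷ map (map₂ (x ∷_)) (picks xs)

picks-~ : ∀ us → All (λ p → proj₁ p ∷ proj₂ p ~ us) (picks us)
picks-~ []       = []
picks-~ (x ∷ xs) = ~-refl ∷ All.map⁺ (All.map swapIn (picks-~ xs))
  where
  swapIn : ∀ {p} → proj₁ p ∷ proj₂ p ~ xs → proj₁ p ∷ x ∷ proj₂ p ~ x ∷ xs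
  swapIn {y , ys} y∷ys~xs = ~-trans (~-swap y x ys) (~-∷ ≅-refl y∷ys~xs)

picks-All : ∀ {Q : Tree → Set} {us} → All Q us → All (Q ∘ proj₁) (picks us)
picks-All []       = []
picks-All (q ∷ qs) = q ∷ All.map⁺ (picks-All qs)

∑-picks-count : ∀ x us → ∑[ p ← picks us ] δ (x ≅ᵇ proj₁ p) ≡ count x us
∑-picks-count x []       = refl
∑-picks-count x (u ∷ us) = cong (δ (x ≅ᵇ u) +_)
  (trans (∑-map (λ p → δ (x ≅ᵇ proj₁ p)) (map₂ (u ∷_)) (picks us)) (∑-picks-count x us))

pick-≅ : ∀ {Q : Tree × List Tree → Set} x us → All Q (picks us) → count x us ≢ 0 →
         ∃ λ p → Q p × x ≅ proj₁ p
pick-≅ x []       _        count≢0 = ⊥-elim (count≢0 refl)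
pick-≅ x (u ∷ us) (q ∷ qs) count≢0 with x ≅ᵇ u in x≅u
... | true  = (u , us) , q , mk≅ x≅u
... | false = let p , qp , x≅p = pick-≅ x us (All.map⁻ qs) count≢0 in map₂ (u ∷_) p , qp , x≅p

count-swap : ∀ x y zs →
             suc (count x (y ∷ zs)) * suc (count y zs) ≡ suc (count y (x ∷ zs)) * suc (count x zs)
count-swap x y zs rewrite ≅ᵇ-sym y x with x ≅ᵇ y in x≅y
... | true  = cong₂ (λ m n → suc (suc m) * suc n) cx≡cy (sym cx≡cy)
  where cx≡cy = count-resp-≅ {x} {y} zs (mk≅ x≅y)
... | false = *-comm (suc (count x zs)) (suc (count y zs))

picks-∣SG∣ : ∀ us → All (λ p → ∣SG∣ (node us) ≡ splitFactor (proj₁ p) (proj₂ p)) (picks us)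
picks-∣SG∣ []       = []
picks-∣SG∣ (x ∷ xs) = ∣SG∣-∷ x xs ∷ All.map⁺ (All.zipWith pickFromTail (picks-~ xs , picks-∣SG∣ xs))
  where
  open ≡-Reasoning
  regroup : ∀ a b m n o → a * m * (b * n * o) ≡ (a * b) * (m * (n * o))
  regroup = solve-∀

  pickFromTail : ∀ {p} → (proj₁ p ∷ proj₂ p ~ xs) × (∣SG∣ (node xs) ≡ splitFactor (proj₁ p) (proj₂ p)) →
                 ∣SG∣ (node (x ∷ xs)) ≡ splitFactor (proj₁ p) (x ∷ proj₂ p)
  pickFromTail {y , ys} (y∷ys~xs , ∣SG∣-xs) = begin
    ∣SG∣ (node (x ∷ xs))
      ≡⟨ ∣SG∣-∷ x xs ⟩
    suc (count x xs) * ∣SG∣ x * ∣SG∣ (node xs)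
      ≡⟨ cong₂ (λ c s → suc c * ∣SG∣ x * s) (sym (count≡ y∷ys~xs x)) ∣SG∣-xs ⟩
    suc (count x (y ∷ ys)) * ∣SG∣ x * (suc (count y ys) * ∣SG∣ y * ∣SG∣ (node ys))
      ≡⟨ regroup (suc (count x (y ∷ ys))) (suc (count y ys)) (∣SG∣ x) (∣SG∣ y) (∣SG∣ (node ys)) ⟩
    (suc (count x (y ∷ ys)) * suc (count y ys)) * (∣SG∣ x * (∣SG∣ y * ∣SG∣ (node ys)))
      ≡⟨ cong₂ _*_ (count-swap x y ys) (*-CS.x∙yz≈y∙xz (∣SG∣ x) (∣SG∣ y) _) ⟩
    (suc (count y (x ∷ ys)) * suc (count x ys)) * (∣SG∣ y * (∣SG∣ x * ∣SG∣ (node ys)))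
      ≡⟨ regroup (suc (count y (x ∷ ys))) (suc (count x ys)) (∣SG∣ y) (∣SG∣ x) (∣SG∣ (node ys)) ⟨
    suc (count y (x ∷ ys)) * ∣SG∣ y * (suc (count x ys) * ∣SG∣ x * ∣SG∣ (node ys))
      ≡⟨ cong (suc (count y (x ∷ ys)) * ∣SG∣ y *_) (∣SG∣-∷ x ys) ⟨
    suc (count y (x ∷ ys)) * ∣SG∣ y * ∣SG∣ (node (x ∷ ys)) ∎

mutual
  ∣SG∣-resp-≅ : ∀ {t u} → t ≅ u → ∣SG∣ t ≡ ∣SG∣ u
  ∣SG∣-resp-≅ {node ts} {node us} t≅u = ∣SG∣-resp-~ (node-≅⇒~ t≅u)

  ∣SG∣-resp-~ : ∀ {ts us} → ts ~ us → ∣SG∣ (node ts) ≡ ∣SG∣ (node us)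
  ∣SG∣-resp-~ {[]}     {[]}     _     = refl
  ∣SG∣-resp-~ {[]}     {u ∷ us} ts~us = contradiction (trans (count≡ ts~us u) (count-here u us)) 0≢1+n
  ∣SG∣-resp-~ {x ∷ xs} {us}     ts~us
    with pick-≅ x us (All.zip (picks-~ us , picks-∣SG∣ us))
                     (λ c≡0 → 1+n≢0 (trans (sym (count-here x xs)) (trans (count≡ ts~us x) c≡0)))
  ... | (b , s) , (b∷s~us , ∣SG∣-us) , x≅b = begin
    ∣SG∣ (node (x ∷ xs))                        ≡⟨ ∣SG∣-∷ x xs ⟩
    suc (count x xs) * ∣SG∣ x * ∣SG∣ (node xs)  ≡⟨ cong₂ _*_ (cong₂ (λ c g → suc c * g) count-x≡count-b
                                                                                    (∣SG∣-resp-≅ x≅b))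
                                                             (∣SG∣-resp-~ xs~s) ⟩
    suc (count b s) * ∣SG∣ b * ∣SG∣ (node s)    ≡⟨ ∣SG∣-us ⟨
    ∣SG∣ (node us)                              ∎
    where
    open ≡-Reasoning
    xs~s : xs ~ s
    xs~s = ~-∷⁻ x≅b (~-trans ts~us (~-sym b∷s~us))
    count-x≡count-b : count x xs ≡ count b s
    count-x≡count-b = trans (count-resp-≅ xs x≅b) (count≡ xs~s b)

-- The integer pairing

⟨_,_⟩ : Tree → Tree → ℕ
⟨ t , u ⟩ = if t ≅ᵇ u then ∣SG∣ t else 0

⟦_,_⟧ : List Tree → List Tree → ℕ
⟦ ts , us ⟧ = ⟨ node ts , node us ⟩

⟨⟩-respˡ : ∀ {t t′} u → t ≅ t′ → ⟨ t , u ⟩ ≡ ⟨ t′ , u ⟩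
⟨⟩-respˡ u t≅t′ rewrite ≅ᵇ-respˡ u t≅t′ | ∣SG∣-resp-≅ t≅t′ = refl

⟨⟩-respʳ : ∀ t {u u′} → u ≅ u′ → ⟨ t , u ⟩ ≡ ⟨ t , u′ ⟩
⟨⟩-respʳ t u≅u′ rewrite ≅ᵇ-respʳ t u≅u′ = refl

⟨⟩-sym : ∀ t u → ⟨ t , u ⟩ ≡ ⟨ u , t ⟩
⟨⟩-sym t u rewrite ≅ᵇ-sym u t with t ≅ᵇ u in t≅u
... | true  = ∣SG∣-resp-≅ {t} {u} (mk≅ t≅u)
... | false = refl

matchAll-∷-pick : ∀ {x xs b s us} → x ≅ b → b ∷ s ~ us → matchAll xs s ≡ matchAll (x ∷ xs) us
matchAll-∷-pick {x} {xs} {b} {s} {us} x≅b b∷s~us = ⇔→≅ᵇ≡ {node xs} {node s} {node (x ∷ xs)} {node us}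
  (λ xs≅s → ~⇒node-≅ (~-trans (~-∷ x≅b (node-≅⇒~ xs≅s)) b∷s~us))
  (λ x∷xs≅us → ~⇒node-≅ (~-∷⁻ x≅b (~-trans (node-≅⇒~ x∷xs≅us) (~-sym b∷s~us))))

-- If x ∷ xs ~ us, exactly count x us = suc (count x xs) picks (b , s) have x ≅ b, and each
-- contributes ∣SG∣ x * ∣SG∣ (node xs); otherwise every term vanishes.
⟦⟧-expandˡ : ∀ x xs us → ⟦ x ∷ xs , us ⟧ ≡ ∑[ p ← picks us ] (⟨ x , proj₁ p ⟩ * ⟦ xs , proj₂ p ⟧)
⟦⟧-expandˡ x xs us = begin
  ⟦ x ∷ xs , us ⟧                                    ≡⟨ total (matchAll (x ∷ xs) us) (node-≅⇒~ ∘ mk≅) ⟨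
  count x us * c                                     ≡⟨ cong (_* c) (∑-picks-count x us) ⟨
  ∑[ p ← picks us ] δ (x ≅ᵇ proj₁ p) * c             ≡⟨ *-distribʳ-∑ c (λ p → δ (x ≅ᵇ proj₁ p)) (picks us) ⟩
  ∑[ p ← picks us ] (δ (x ≅ᵇ proj₁ p) * c)           ≡⟨ ∑-cong-All (picks us) (All.map term (picks-~ us)) ⟨
  ∑[ p ← picks us ] (⟨ x , proj₁ p ⟩ * ⟦ xs , proj₂ p ⟧) ∎
  where
  open ≡-Reasoning
  c : ℕ
  c = if matchAll (x ∷ xs) us then ∣SG∣ x * ∣SG∣ (node xs) else 0

  *-if : ∀ m → ∣SG∣ x * (if m then ∣SG∣ (node xs) else 0) ≡ (if m then ∣SG∣ x * ∣SG∣ (node xs) else 0)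
  *-if true  = refl
  *-if false = *-zeroʳ (∣SG∣ x)

  term : ∀ {p} → proj₁ p ∷ proj₂ p ~ us → ⟨ x , proj₁ p ⟩ * ⟦ xs , proj₂ p ⟧ ≡ δ (x ≅ᵇ proj₁ p) * c
  term {b , s} b∷s~us with x ≅ᵇ b in x≅b
  ... | false = refl
  ... | true  = begin
    ∣SG∣ x * (if matchAll xs s then ∣SG∣ (node xs) else 0)
      ≡⟨ cong (λ m → ∣SG∣ x * (if m then ∣SG∣ (node xs) else 0)) (matchAll-∷-pick (mk≅ x≅b) b∷s~us) ⟩
    ∣SG∣ x * (if matchAll (x ∷ xs) us then ∣SG∣ (node xs) else 0)
      ≡⟨ *-if (matchAll (x ∷ xs) us) ⟩
    c
      ≡⟨ *-identityˡ c ⟨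
    1 * c ∎

  total : ∀ m → (m ≡ true → x ∷ xs ~ us) →
          count x us * (if m then ∣SG∣ x * ∣SG∣ (node xs) else 0) ≡ (if m then ∣SG∣ (node (x ∷ xs)) else 0)
  total false _       = *-zeroʳ (count x us)
  total true  x∷xs~us = begin
    count x us * (∣SG∣ x * ∣SG∣ (node xs))        ≡⟨ cong (_* (∣SG∣ x * ∣SG∣ (node xs)))
                                                         (trans (sym (count≡ (x∷xs~us refl) x)) (count-here x xs)) ⟩
    suc (count x xs) * (∣SG∣ x * ∣SG∣ (node xs))  ≡⟨ *-assoc (suc (count x xs)) (∣SG∣ x) (∣SG∣ (node xs)) ⟨
    splitFactor x xs                              ≡⟨ ∣SG∣-∷ x xs ⟨
    ∣SG∣ (node (x ∷ xs))                          ∎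

⟦⟧-expandʳ : ∀ ts y ys → ⟦ ts , y ∷ ys ⟧ ≡ ∑[ p ← picks ts ] (⟨ proj₁ p , y ⟩ * ⟦ proj₂ p , ys ⟧)
⟦⟧-expandʳ ts y ys = begin
  ⟦ ts , y ∷ ys ⟧                                         ≡⟨ ⟨⟩-sym (node ts) _ ⟩
  ⟦ y ∷ ys , ts ⟧                                         ≡⟨ ⟦⟧-expandˡ y ys ts ⟩
  ∑[ p ← picks ts ] (⟨ y , proj₁ p ⟩ * ⟦ ys , proj₂ p ⟧)  ≡⟨ ∑-cong swap (picks ts) ⟩
  ∑[ p ← picks ts ] (⟨ proj₁ p , y ⟩ * ⟦ proj₂ p , ys ⟧)  ∎
  where
  open ≡-Reasoning
  swap : ∀ p → ⟨ y , proj₁ p ⟩ * ⟦ ys , proj₂ p ⟧ ≡ ⟨ proj₁ p , y ⟩ * ⟦ proj₂ p , ys ⟧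
  swap (b , s) = cong₂ _*_ (⟨⟩-sym y b) (⟨⟩-sym (node ys) (node s))

-- Growing and pruning act on a single child

~-Invariant : (List Tree → ℕ) → Set
~-Invariant F = ∀ {ts us} → ts ~ us → F ts ≡ F us

∑-growL : ∀ F → ~-Invariant F → ∀ ts →
          ∑ F (growL ts) ≡ ∑[ p ← picks ts ] ∑[ a ← grow (proj₁ p) ] F (a ∷ proj₂ p)
∑-growL F inv []       = refl
∑-growL F inv (x ∷ xs) = begin
  ∑ F (map (_∷ xs) (grow x) ++ map (x ∷_) (growL xs))
    ≡⟨ ∑-++ F (map (_∷ xs) (grow x)) _ ⟩
  ∑ F (map (_∷ xs) (grow x)) + ∑ F (map (x ∷_) (growL xs))
    ≡⟨ cong₂ _+_ (∑-map F (_∷ xs) (grow x)) (∑-map F (x ∷_) (growL xs)) ⟩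
  ∑[ a ← grow x ] F (a ∷ xs) + ∑[ l ← growL xs ] F (x ∷ l)
    ≡⟨ cong (∑[ a ← grow x ] F (a ∷ xs) +_)
            (trans (∑-growL (F ∘ (x ∷_)) (inv ∘ ~-∷ ≅-refl) xs) reindex) ⟩
  ∑[ a ← grow x ] F (a ∷ xs) + ∑[ p ← map (map₂ (x ∷_)) (picks xs) ] ∑[ a ← grow (proj₁ p) ] F (a ∷ proj₂ p) ∎
  where
  open ≡-Reasoning
  reindex : ∑[ p ← picks xs ] ∑[ a ← grow (proj₁ p) ] F (x ∷ a ∷ proj₂ p) ≡
            ∑[ p ← map (map₂ (x ∷_)) (picks xs) ] ∑[ a ← grow (proj₁ p) ] F (a ∷ proj₂ p)
  reindex = trans (∑-cong (λ p → ∑-cong (λ a → inv (~-swap x a (proj₂ p))) (grow (proj₁ p))) (picks xs))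
                  (sym (∑-map _ (map₂ (x ∷_)) (picks xs)))

-- ⟨ • , b ⟩ is 1 if b is a leaf and 0 otherwise.
∑-pruneL-∷ : ∀ F x xs →
             ∑ F (pruneL (x ∷ xs)) ≡
             (⟨ • , x ⟩ * F xs + ∑[ b ← prune x ] F (b ∷ xs)) + ∑[ l ← pruneL xs ] F (x ∷ l)
∑-pruneL-∷ F (node [])        xs =
  cong₂ _+_ (sym (trans (+-identityʳ _) (*-identityˡ (F xs)))) (∑-map F (• ∷_) (pruneL xs))
∑-pruneL-∷ F x@(node (_ ∷ _)) xs =
  trans (∑-++ F (map (_∷ xs) (prune x)) _) (cong₂ _+_ (∑-map F (_∷ xs) (prune x)) (∑-map F (x ∷_) (pruneL xs)))

∑-pruneL : ∀ F → ~-Invariant F → ∀ us →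
           ∑ F (pruneL us) ≡
           ∑[ p ← picks us ] (⟨ • , proj₁ p ⟩ * F (proj₂ p) + ∑[ b ← prune (proj₁ p) ] F (b ∷ proj₂ p))
∑-pruneL F inv []       = refl
∑-pruneL F inv (x ∷ xs) =
  trans (∑-pruneL-∷ F x xs)
        (cong (H F (x , xs) +_) (trans (∑-pruneL (F ∘ (x ∷_)) (inv ∘ ~-∷ ≅-refl) xs) reindex))
  where
  H : (List Tree → ℕ) → Tree × List Tree → ℕ
  H G p = ⟨ • , proj₁ p ⟩ * G (proj₂ p) + ∑[ b ← prune (proj₁ p) ] G (b ∷ proj₂ p)

  reindex : ∑[ p ← picks xs ] H (F ∘ (x ∷_)) p ≡ ∑[ p ← map (map₂ (x ∷_)) (picks xs) ] H F p
  reindex = trans (∑-cong (λ p → cong (⟨ • , proj₁ p ⟩ * F (x ∷ proj₂ p) +_)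
                                      (∑-cong (λ b → inv (~-swap x b (proj₂ p))) (prune (proj₁ p))))
                          (picks xs))
                  (sym (∑-map (H F) (map₂ (x ∷_)) (picks xs)))

crossSum : (Tree → Tree → ℕ) → List Tree → List Tree → ℕ
crossSum K ts us = ∑[ p ← picks ts ] ∑[ q ← picks us ] (K (proj₁ p) (proj₁ q) * ⟦ proj₂ p , proj₂ q ⟧)

crossSum-cong : ∀ {K K′} ts us → All (λ a → ∀ b → K a b ≡ K′ a b) ts → crossSum K ts us ≡ crossSum K′ ts us
crossSum-cong ts us K≡K′ =
  ∑-cong-All (picks ts) (All.map (λ K≡ → ∑-cong (λ q → cong (_* _) (K≡ (proj₁ q))) (picks us)) (picks-All K≡K′))

∑-growL-⟦⟧ : ∀ ts us → ∑[ l ← growL ts ] ⟦ l , us ⟧ ≡ crossSum (λ a b → ∑[ a′ ← grow a ] ⟨ a′ , b ⟩) ts us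
∑-growL-⟦⟧ ts us = begin
  ∑[ l ← growL ts ] ⟦ l , us ⟧
    ≡⟨ ∑-growL (λ l → ⟦ l , us ⟧) (λ l~l′ → ⟨⟩-respˡ (node us) (~⇒node-≅ l~l′)) ts ⟩
  ∑[ p ← picks ts ] ∑[ a ← grow (proj₁ p) ] ⟦ a ∷ proj₂ p , us ⟧
    ≡⟨ ∑-cong (λ p → ∑-cong (λ a → ⟦⟧-expandˡ a (proj₂ p) us) (grow (proj₁ p))) (picks ts) ⟩
  ∑[ p ← picks ts ] ∑[ a ← grow (proj₁ p) ] ∑[ q ← picks us ] (⟨ a , proj₁ q ⟩ * ⟦ proj₂ p , proj₂ q ⟧)
    ≡⟨ ∑-cong (λ p → ∑-comm-distribʳ (λ a q → ⟨ a , proj₁ q ⟩) (λ q → ⟦ proj₂ p , proj₂ q ⟧)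
                                      (grow (proj₁ p)) (picks us)) (picks ts) ⟩
  crossSum (λ a b → ∑[ a′ ← grow a ] ⟨ a′ , b ⟩) ts us ∎
  where open ≡-Reasoning

∑-pruneL-⟦⟧ : ∀ ts us →
              ∑[ l ← pruneL us ] ⟦ ts , l ⟧ ≡ ⟦ • ∷ ts , us ⟧ + crossSum (λ a b → ∑[ b′ ← prune b ] ⟨ a , b′ ⟩) ts us
∑-pruneL-⟦⟧ ts us = begin
  ∑[ l ← pruneL us ] ⟦ ts , l ⟧
    ≡⟨ ∑-pruneL (λ l → ⟦ ts , l ⟧) (λ l~l′ → ⟨⟩-respʳ (node ts) (~⇒node-≅ l~l′)) us ⟩
  ∑[ q ← picks us ] (leaf q + ∑[ b ← prune (proj₁ q) ] ⟦ ts , b ∷ proj₂ q ⟧)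
    ≡⟨ ∑-distrib-+ leaf _ (picks us) ⟩
  ∑ leaf (picks us) + ∑[ q ← picks us ] ∑[ b ← prune (proj₁ q) ] ⟦ ts , b ∷ proj₂ q ⟧
    ≡⟨ cong₂ _+_ (sym (⟦⟧-expandˡ • ts us))
                 (∑-cong (λ q → ∑-cong (λ b → ⟦⟧-expandʳ ts b (proj₂ q)) (prune (proj₁ q))) (picks us)) ⟩
  ⟦ • ∷ ts , us ⟧ +
  ∑[ q ← picks us ] ∑[ b ← prune (proj₁ q) ] ∑[ p ← picks ts ] (⟨ proj₁ p , b ⟩ * ⟦ proj₂ p , proj₂ q ⟧)
    ≡⟨ cong (⟦ • ∷ ts , us ⟧ +_) (trans
         (∑-cong (λ q → ∑-comm-distribʳ (λ b p → ⟨ proj₁ p , b ⟩) (λ p → ⟦ proj₂ p , proj₂ q ⟧)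
                                        (prune (proj₁ q)) (picks ts)) (picks us))
         (∑-comm _ (picks us) (picks ts))) ⟩
  ⟦ • ∷ ts , us ⟧ + crossSum (λ a b → ∑[ b′ ← prune b ] ⟨ a , b′ ⟩) ts us ∎
  where
  open ≡-Reasoning
  leaf : Tree × List Tree → ℕ
  leaf q = ⟨ • , proj₁ q ⟩ * ⟦ ts , proj₂ q ⟧

mutual
  grow-prune-adjoint : ∀ t u → ∑[ t′ ← grow t ] ⟨ t′ , u ⟩ ≡ ∑[ u′ ← prune u ] ⟨ t , u′ ⟩
  grow-prune-adjoint (node ts) (node us) = begin
    ⟦ • ∷ ts , us ⟧ + ∑[ t′ ← map node (growL ts) ] ⟨ t′ , node us ⟩
      ≡⟨ cong (⟦ • ∷ ts , us ⟧ +_) (trans (∑-map _ node (growL ts)) (∑-growL-⟦⟧ ts us)) ⟩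
    ⟦ • ∷ ts , us ⟧ + crossSum (λ a b → ∑[ a′ ← grow a ] ⟨ a′ , b ⟩) ts us
      ≡⟨ cong (⟦ • ∷ ts , us ⟧ +_) (crossSum-cong ts us (grow-prune-adjoint-All ts)) ⟩
    ⟦ • ∷ ts , us ⟧ + crossSum (λ a b → ∑[ b′ ← prune b ] ⟨ a , b′ ⟩) ts us
      ≡⟨ ∑-pruneL-⟦⟧ ts us ⟨
    ∑[ l ← pruneL us ] ⟦ ts , l ⟧
      ≡⟨ ∑-map _ node (pruneL us) ⟨
    ∑[ u′ ← map node (pruneL us) ] ⟨ node ts , u′ ⟩ ∎
    where open ≡-Reasoning

  grow-prune-adjoint-All : ∀ ts → All (λ a → ∀ b → ∑[ a′ ← grow a ] ⟨ a′ , b ⟩ ≡ ∑[ b′ ← prune b ] ⟨ a , b′ ⟩) ts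
  grow-prune-adjoint-All []       = []
  grow-prune-adjoint-All (t ∷ ts) = grow-prune-adjoint t ∷ grow-prune-adjoint-All ts

module Coefficients {c ℓ} (k : CommutativeRing c ℓ) where
  private
    module K  = CommutativeRing k
    module K∑ = ListSum K.commutativeSemiring
  open FreeSpace k
  open import Relation.Binary.Reasoning.Setoid K.setoid

  ι-+ : ∀ m n → ι k (m + n) K.≈ ι k m K.+ ι k n
  ι-+ zero    n = K.sym (K.+-identityˡ (ι k n))
  ι-+ (suc m) n = K.trans (K.+-congˡ (ι-+ m n)) (K.sym (K.+-assoc K.1# (ι k m) (ι k n)))

  ι-∑ : ∀ {A : Set} (f : A → ℕ) xs → ι k (∑ f xs) K.≈ K∑.∑[ x ← xs ] ι k (f x)
  ι-∑ f []       = K.refl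
  ι-∑ f (x ∷ xs) = K.trans (ι-+ (f x) (∑ f xs)) (K.+-congˡ (ι-∑ f xs))

  ⟪⟫ₜ≈ι⟨⟩ : ∀ t u → ⟪ t , u ⟫ₜ K.≈ ι k ⟨ t , u ⟩
  ⟪⟫ₜ≈ι⟨⟩ t u = K.reflexive (sym (if-float (ι k) (t ≅ᵇ u)))

  grow-prune-adjointₖ : ∀ t u → K∑.∑[ t′ ← grow t ] ⟪ t′ , u ⟫ₜ K.≈ K∑.∑[ u′ ← prune u ] ⟪ t , u′ ⟫ₜ
  grow-prune-adjointₖ t u = begin
    K∑.∑[ t′ ← grow t ] ⟪ t′ , u ⟫ₜ      ≈⟨ K∑.∑-cong (λ t′ → ⟪⟫ₜ≈ι⟨⟩ t′ u) (grow t) ⟩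
    K∑.∑[ t′ ← grow t ] ι k ⟨ t′ , u ⟩   ≈⟨ ι-∑ (λ t′ → ⟨ t′ , u ⟩) (grow t) ⟨
    ι k (∑[ t′ ← grow t ] ⟨ t′ , u ⟩)    ≡⟨ cong (ι k) (grow-prune-adjoint t u) ⟩
    ι k (∑[ u′ ← prune u ] ⟨ t , u′ ⟩)   ≈⟨ ι-∑ (λ u′ → ⟨ t , u′ ⟩) (prune u) ⟩
    K∑.∑[ u′ ← prune u ] ι k ⟨ t , u′ ⟩  ≈⟨ K∑.∑-cong (λ u′ → ⟪⟫ₜ≈ι⟨⟩ t u′) (prune u) ⟨
    K∑.∑[ u′ ← prune u ] ⟪ t , u′ ⟫ₜ     ∎

proposition2p3 : {c ℓ : Level} (k : CommutativeRing c ℓ) → IsFieldChar0 k → (x y : FreeSpace.kT k) → CommutativeRing._≈_ k (FreeSpace.⟪_,_⟫ k (FreeSpace.𝔑 k x) y) (FreeSpace.⟪_,_⟫ k x (FreeSpace.𝔓 k y))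
proposition2p3 k _ = Bilinear.extend-adjoint k grow prune (Coefficients.grow-prune-adjointₖ k)
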